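{- Let $s$ be a non-negative integer. Then \[ \mathbb A A_s (\tau ) + \mathbb B A_s (\sigma ) = \sum_{t = 0}^s A(s,t)w^* _t,\qquad \mathbb A A_s (\tau ) - \mathbb B A_s (\sigma ) = \frac{1}{\Delta }\sum_{t = 0}^s A(s,t)(w^* _{t + 1} - qw^* _{t - 1} ). \]
   Context: Let $a,b,q$ be complex numbers with $q\ne0$ and $1-4q\ne0$. Define $(w^*_j)$ by $w^*_0=a$, $w^*_1=b$, $w^*_j=w^*_{j-1}-qw^*_{j-2}$ for $j\ge2$, extended to negative indices by $w^*_{ -j}=(w^*_{ -j+1}-w^*_{ -j+2})/q$. Let $\Delta=\sqrt{1-4q}$ (a fixed square root), $\tau=(1+\Delta)/2$, $\sigma=(1-\Delta)/2$ (so $\tau+\sigma=1$, $\tau\sigma=q$), and $\mathbb A=(b-a\sigma)/(\tau-\sigma)$, $\mathbb B=(a\tau-b)/(\tau-\sigma)$, so that $w^*_j=\mathbb A\tau^j+\mathbb B\sigma^j$. The Eulerian numbers are $A(i,j)=\sum_{t=0}^j(-1)^t\binom{i+1}{t}(j-t)^i$ for non-negative integers $i,j$ (with $0^0=1$), and $A_i(x)=\sum_{j=0}^iA(i,j)x^j$. -}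

module Defs where

open import Level using (Level; _⊔_)
open import Algebra.Bundles using (CommutativeRing)
open import Data.Nat as ℕ using (ℕ; zero; suc; _∸_)
open import Data.Nat.Combinatorics using (_C_)
open import Data.Integer as ℤ using (ℤ; +_; -[1+_])
open import Data.Product using (_×_; _,_; proj₁)
open import Relation.Nullary using (¬_)

sumℤ : (ℕ → ℤ) → ℕ → ℤ
sumℤ f zero    = f zero
sumℤ f (suc n) = sumℤ f n ℤ.+ f (suc n)

-- Eulerian numbers  A(i,j) = Σ_{t=0}^{j} (-1)^t C(i+1,t) (j-t)^i   (with 0^0 = 1)
signℤ : ℕ → ℤ
signℤ zero          = + 1
signℤ (suc zero)    = ℤ.- (+ 1)
signℤ (suc (suc t)) = signℤ t

Eulerian : ℕ → ℕ → ℤ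
Eulerian i j = sumℤ (λ t → signℤ t ℤ.* (+ ((suc i C t) ℕ.* ((j ∸ t) ℕ.^ i)))) j

-- A field of characteristic zero, presented as a commutative ring with an
-- inverse operation on non-zero elements (the ambient field plays the role of ℂ).
module _ {c ℓ : Level} (R : CommutativeRing c ℓ) where
  open CommutativeRing R hiding (zero)

  fromℕ : ℕ → Carrier
  fromℕ zero    = 0#
  fromℕ (suc n) = 1# + fromℕ n

  fromℤ : ℤ → Carrier
  fromℤ (+ n)      = fromℕ n
  fromℤ -[1+ n ]   = - fromℕ (suc n)

  record CharZeroField : Set (c ⊔ ℓ) where
    field
      inv        : Carrier → Carrier
      1≉0        : ¬ (1# ≈ 0#)
      inverseʳ   : ∀ x → ¬ (x ≈ 0#) → x * inv x ≈ 1#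
      charZero   : ∀ n → ¬ (fromℕ (suc n) ≈ 0#)

  pow : Carrier → ℕ → Carrier
  pow x zero    = 1#
  pow x (suc n) = x * pow x n

  sumR : (ℕ → Carrier) → ℕ → Carrier
  sumR f zero    = f zero
  sumR f (suc n) = sumR f n + f (suc n)

  EulerianPoly : ℕ → Carrier → Carrier
  EulerianPoly i x = sumR (λ j → fromℤ (Eulerian i j) * pow x j) i

  -- Setting of the paper: a, b, q, Δ with Δ² = 1 - 4q
  module Setting (F : CharZeroField) (a b q Δ : Carrier) where
    open CharZeroField F

    _/_ : Carrier → Carrier → Carrier
    x / y = x * inv y

    τ σ 𝔸 𝔹 : Carrier
    τ = (1# + Δ) / fromℕ 2
    σ = (1# - Δ) / fromℕ 2
    𝔸 = (b - a * σ) / (τ - σ)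
    𝔹 = (a * τ - b) / (τ - σ)

    wPos : ℕ → Carrier
    wPos zero          = a
    wPos (suc zero)    = b
    wPos (suc (suc j)) = wPos (suc j) - q * wPos j

    -- (w*_{-n}, w*_{-n+1}) computed by w*_{-j} = (w*_{-j+1} - w*_{-j+2}) / q
    wDown : ℕ → Carrier × Carrier
    wDown zero    = a , b
    wDown (suc n) with wDown n
    ... | (x , y) = (x - y) / q , x

    w* : ℤ → Carrier
    w* (+ n)      = wPos n
    w* -[1+ n ]   = proj₁ (wDown (suc n))

{-# OPTIONS --safe #-}

-- Since τ and σ are the roots of x² - x + q, Binet's formula w*ₜ = 𝔸 τᵗ + 𝔹 σᵗ
-- holds for t ≥ 0, and also q w*ₜ₋₁ = 𝔸 σ τᵗ + 𝔹 τ σᵗ for t ≥ 0 (at t = 0 this is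
-- a - b = 𝔸 σ + 𝔹 τ).  Hence w*ₜ₊₁ - q w*ₜ₋₁ = Δ (𝔸 τᵗ - 𝔹 σᵗ).  Both identities
-- are then linear combinations of these, weighted by the Eulerian numbers; in
-- fact they hold for arbitrary coefficients in place of A(s,t).
module Submission where

open import Defs
open import Level using (Level)
open import Algebra.Bundles using (CommutativeRing)
open import Data.Nat as ℕ using (ℕ; zero; suc)
import Data.Nat.Properties as ℕ
open import Data.Integer as ℤ using (ℤ; +_; -[1+_])
import Data.Integer.Properties as ℤ
import Data.Sign as Sign
open import Data.Maybe using (Maybe; map)
open import Data.Product using (_×_; _,_)
open import Relation.Nullary using (¬_)
open import Relation.Binary.Consequences using (dec⇒weaklyDec)
import Relation.Binary.PropositionalEquality as ≡
import Algebra.Properties.Ring as RingProperties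
import Algebra.Properties.Semiring.Mult as SemiringMult
import Algebra.Properties.CommutativeSemigroup as CommutativeSemigroupProperties
import Algebra.Solver.Ring.AlmostCommutativeRing as ACR
import Algebra.Solver.Ring
import Relation.Binary.Reasoning.Setoid as SetoidReasoning

module IntegerCoefficients {c ℓ : Level} (R : CommutativeRing c ℓ) where
  open CommutativeRing R hiding (zero)
  open RingProperties ring
  open SemiringMult semiring using (×-homo-+; ×1-homo-*) renaming (_×_ to _·_)
  open CommutativeSemigroupProperties +-commutativeSemigroup using (interchange)
  open SetoidReasoning setoid

  fromℕ≈·1# : ∀ n → fromℕ R n ≈ n · 1#
  fromℕ≈·1# zero    = refl
  fromℕ≈·1# (suc n) = +-congˡ (fromℕ≈·1# n)

  fromℕ-homo-+ : ∀ m n → fromℕ R (m ℕ.+ n) ≈ fromℕ R m + fromℕ R n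
  fromℕ-homo-+ m n = begin
    fromℕ R (m ℕ.+ n)          ≈⟨ fromℕ≈·1# (m ℕ.+ n) ⟩
    (m ℕ.+ n) · 1#             ≈⟨ ×-homo-+ 1# m n ⟩
    m · 1# + n · 1#            ≈⟨ +-cong (fromℕ≈·1# m) (fromℕ≈·1# n) ⟨
    fromℕ R m + fromℕ R n      ∎

  fromℕ-homo-* : ∀ m n → fromℕ R (m ℕ.* n) ≈ fromℕ R m * fromℕ R n
  fromℕ-homo-* m n = begin
    fromℕ R (m ℕ.* n)          ≈⟨ fromℕ≈·1# (m ℕ.* n) ⟩
    (m ℕ.* n) · 1#             ≈⟨ ×1-homo-* m n ⟩
    (m · 1#) * (n · 1#)        ≈⟨ *-cong (fromℕ≈·1# m) (fromℕ≈·1# n) ⟨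
    fromℕ R m * fromℕ R n      ∎

  fromℤ-⊖ : ∀ m n → fromℤ R (m ℤ.⊖ n) ≈ fromℕ R m - fromℕ R n
  fromℤ-⊖ m       zero    = sym (trans (+-congˡ -0#≈0#) (+-identityʳ _))
  fromℤ-⊖ zero    (suc n) = sym (+-identityˡ _)
  fromℤ-⊖ (suc m) (suc n) = begin
    fromℤ R (suc m ℤ.⊖ suc n)            ≡⟨ ≡.cong (fromℤ R) (ℤ.[1+m]⊖[1+n]≡m⊖n m n) ⟩
    fromℤ R (m ℤ.⊖ n)                    ≈⟨ fromℤ-⊖ m n ⟩
    fromℕ R m - fromℕ R n                ≈⟨ +-identityˡ _ ⟨
    0# + (fromℕ R m - fromℕ R n)         ≈⟨ +-congʳ (-‿inverseʳ 1#) ⟨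
    (1# - 1#) + (fromℕ R m - fromℕ R n)  ≈⟨ interchange 1# (- 1#) (fromℕ R m) (- fromℕ R n) ⟩
    (1# + fromℕ R m) + (- 1# - fromℕ R n) ≈⟨ +-congˡ (-‿+-comm 1# (fromℕ R n)) ⟩
    fromℕ R (suc m) - fromℕ R (suc n)    ∎

  fromℤ-homo-+ : ∀ i j → fromℤ R (i ℤ.+ j) ≈ fromℤ R i + fromℤ R j
  fromℤ-homo-+ (+ m)    (+ n)    = fromℕ-homo-+ m n
  fromℤ-homo-+ (+ m)    -[1+ n ] = fromℤ-⊖ m (suc n)
  fromℤ-homo-+ -[1+ m ] (+ n)    = trans (fromℤ-⊖ n (suc m)) (+-comm _ _)
  fromℤ-homo-+ -[1+ m ] -[1+ n ] = begin
    - fromℕ R (suc (suc (m ℕ.+ n)))      ≡⟨ ≡.cong (λ k → - fromℕ R k) (ℕ.+-suc (suc m) n) ⟨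
    - fromℕ R (suc m ℕ.+ suc n)          ≈⟨ -‿cong (fromℕ-homo-+ (suc m) (suc n)) ⟩
    - (fromℕ R (suc m) + fromℕ R (suc n)) ≈⟨ -‿+-comm _ _ ⟨
    - fromℕ R (suc m) - fromℕ R (suc n)  ∎

  fromℤ-homo-- : ∀ i → fromℤ R (ℤ.- i) ≈ - fromℤ R i
  fromℤ-homo-- (+ zero)  = sym -0#≈0#
  fromℤ-homo-- (+ suc n) = refl
  fromℤ-homo-- -[1+ n ]  = sym (-‿involutive _)

  fromℤ-+◃ : ∀ n → fromℤ R (Sign.+ ℤ.◃ n) ≈ fromℕ R n
  fromℤ-+◃ zero    = refl
  fromℤ-+◃ (suc n) = refl

  fromℤ--◃ : ∀ n → fromℤ R (Sign.- ℤ.◃ n) ≈ - fromℕ R n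
  fromℤ--◃ zero    = sym -0#≈0#
  fromℤ--◃ (suc n) = refl

  fromℤ-homo-* : ∀ i j → fromℤ R (i ℤ.* j) ≈ fromℤ R i * fromℤ R j
  fromℤ-homo-* (+ m) (+ n) = trans (fromℤ-+◃ (m ℕ.* n)) (fromℕ-homo-* m n)
  fromℤ-homo-* (+ m) -[1+ n ] = begin
    fromℤ R (Sign.- ℤ.◃ m ℕ.* suc n)     ≈⟨ fromℤ--◃ (m ℕ.* suc n) ⟩
    - fromℕ R (m ℕ.* suc n)              ≈⟨ -‿cong (fromℕ-homo-* m (suc n)) ⟩
    - (fromℕ R m * fromℕ R (suc n))      ≈⟨ -‿distribʳ-* _ _ ⟩
    fromℕ R m * - fromℕ R (suc n)        ∎
  fromℤ-homo-* -[1+ m ] (+ n) = begin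
    fromℤ R (Sign.- ℤ.◃ suc m ℕ.* n)     ≈⟨ fromℤ--◃ (suc m ℕ.* n) ⟩
    - fromℕ R (suc m ℕ.* n)              ≈⟨ -‿cong (fromℕ-homo-* (suc m) n) ⟩
    - (fromℕ R (suc m) * fromℕ R n)      ≈⟨ -‿distribˡ-* _ _ ⟩
    - fromℕ R (suc m) * fromℕ R n        ∎
  fromℤ-homo-* -[1+ m ] -[1+ n ] = begin
    fromℤ R (Sign.+ ℤ.◃ suc m ℕ.* suc n) ≈⟨ fromℤ-+◃ (suc m ℕ.* suc n) ⟩
    fromℕ R (suc m ℕ.* suc n)            ≈⟨ fromℕ-homo-* (suc m) (suc n) ⟩
    fromℕ R (suc m) * fromℕ R (suc n)    ≈⟨ minus-*-minus _ _ ⟨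
    - fromℕ R (suc m) * - fromℕ R (suc n) ∎
    where
    minus-*-minus : ∀ x y → - x * - y ≈ x * y
    minus-*-minus x y = begin
      - x * - y      ≈⟨ -‿distribʳ-* (- x) y ⟨
      - (- x * y)    ≈⟨ -‿cong (-‿distribˡ-* x y) ⟨
      - - (x * y)    ≈⟨ -‿involutive (x * y) ⟩
      x * y          ∎

  fromℤ-morphism : ℤ.+-*-rawRing ACR.-Raw-AlmostCommutative⟶ ACR.fromCommutativeRing R
  fromℤ-morphism = record
    { ⟦_⟧    = fromℤ R
    ; +-homo = fromℤ-homo-+
    ; *-homo = fromℤ-homo-*
    ; -‿homo = fromℤ-homo--
    ; 0-homo = refl
    ; 1-homo = +-identityʳ 1#
    }

  fromℤ-weaklyDec : ∀ i j → Maybe (fromℤ R i ≈ fromℤ R j)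
  fromℤ-weaklyDec i j = map (λ { ≡.refl → refl }) (dec⇒weaklyDec ℤ._≟_ i j)

  open Algebra.Solver.Ring ℤ.+-*-rawRing (ACR.fromCommutativeRing R)
         fromℤ-morphism fromℤ-weaklyDec public

module PowerSums {c ℓ : Level} (R : CommutativeRing c ℓ) where
  open CommutativeRing R hiding (zero)
  open IntegerCoefficients R
  open SetoidReasoning setoid

  polyEval : (ℕ → Carrier) → ℕ → Carrier → Carrier
  polyEval e n x = sumR R (λ t → e t * pow R x t) n

  sumR-cong : ∀ {f g : ℕ → Carrier} → (∀ t → f t ≈ g t) → ∀ n → sumR R f n ≈ sumR R g n
  sumR-cong f≈g zero    = f≈g zero
  sumR-cong f≈g (suc n) = +-cong (sumR-cong f≈g n) (f≈g (suc n))

  sumR-linear : ∀ u v (f g : ℕ → Carrier) n →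
                u * sumR R f n + v * sumR R g n ≈ sumR R (λ t → u * f t + v * g t) n
  sumR-linear u v f g zero    = refl
  sumR-linear u v f g (suc n) = begin
    u * (F + f (suc n)) + v * (G + g (suc n))
      ≈⟨ solve 6 (λ u v F f G g → u :* (F :+ f) :+ v :* (G :+ g)
                                  := (u :* F :+ v :* G) :+ (u :* f :+ v :* g))
               refl u v F (f (suc n)) G (g (suc n)) ⟩
    (u * F + v * G) + (u * f (suc n) + v * g (suc n))
      ≈⟨ +-congʳ (sumR-linear u v f g n) ⟩
    sumR R (λ t → u * f t + v * g t) n + (u * f (suc n) + v * g (suc n)) ∎
    where
    F = sumR R f n
    G = sumR R g n

  polyEval-linear : ∀ (e : ℕ → Carrier) n u v x y →
                    u * polyEval e n x + v * polyEval e n y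
                      ≈ sumR R (λ t → e t * (u * pow R x t + v * pow R y t)) n
  polyEval-linear e n u v x y =
    trans (sumR-linear u v _ _ n) (sumR-cong factor-coefficient n)
    where
    factor-coefficient : ∀ t → u * (e t * pow R x t) + v * (e t * pow R y t)
                                ≈ e t * (u * pow R x t + v * pow R y t)
    factor-coefficient t =
      solve 5 (λ u v e X Y → u :* (e :* X) :+ v :* (e :* Y) := e :* (u :* X :+ v :* Y))
            refl u v (e t) (pow R x t) (pow R y t)

module _ {c ℓ : Level} (R : CommutativeRing c ℓ) (F : CharZeroField R) where
  open CommutativeRing R hiding (zero)
  open CharZeroField F
  open IntegerCoefficients R
  open PowerSums R
  open SetoidReasoning setoid

  x*[y*x⁻¹]≈y : ∀ {x} y → ¬ (x ≈ 0#) → x * (y * inv x) ≈ y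
  x*[y*x⁻¹]≈y {x} y x≉0 = begin
    x * (y * inv x)  ≈⟨ solve 3 (λ x y z → x :* (y :* z) := y :* (x :* z)) refl x y (inv x) ⟩
    y * (x * inv x)  ≈⟨ *-congˡ (inverseʳ x x≉0) ⟩
    y * 1#           ≈⟨ *-identityʳ y ⟩
    y                ∎

  root-square : ∀ {u v q} → u + v ≈ 1# → u * v ≈ q → u * u ≈ u - q
  root-square {u} {v} {q} u+v≈1 u*v≈q = begin
    u * u                ≈⟨ solve 2 (λ u v → u :* u := u :* (u :+ v) :- u :* v) refl u v ⟩
    u * (u + v) - u * v  ≈⟨ +-cong (*-congˡ u+v≈1) (-‿cong u*v≈q) ⟩
    u * 1# - q           ≈⟨ +-congʳ (*-identityʳ u) ⟩
    u - q                ∎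

  module Binet (a b q Δ : Carrier) (q≉0 : ¬ (q ≈ 0#))
    {x y A B : Carrier} (x+y≈1 : x + y ≈ 1#) (x*y≈q : x * y ≈ q)
    (A+B≈a : A + B ≈ a) (Ax+By≈b : A * x + B * y ≈ b)
    where
    open Setting R F a b q Δ

    wPos-binet : ∀ n → wPos n ≈ A * pow R x n + B * pow R y n
    wPos-binet zero          = sym (trans (+-cong (*-identityʳ A) (*-identityʳ B)) A+B≈a)
    wPos-binet (suc zero)    =
      sym (trans (+-cong (*-congˡ (*-identityʳ x)) (*-congˡ (*-identityʳ y))) Ax+By≈b)
    wPos-binet (suc (suc n)) = begin
      wPos (suc n) - q * wPos n
        ≈⟨ +-cong (wPos-binet (suc n)) (-‿cong (*-congˡ (wPos-binet n))) ⟩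
      (A * (x * X) + B * (y * Y)) - q * (A * X + B * Y)
        ≈⟨ solve 7 (λ A B x y q X Y → (A :* (x :* X) :+ B :* (y :* Y)) :- q :* (A :* X :+ B :* Y)
                                       := A :* ((x :- q) :* X) :+ B :* ((y :- q) :* Y))
                 refl A B x y q X Y ⟩
      A * ((x - q) * X) + B * ((y - q) * Y)
        ≈⟨ +-cong (*-congˡ (*-congʳ (sym (root-square x+y≈1 x*y≈q))))
                  (*-congˡ (*-congʳ (sym (root-square (trans (+-comm y x) x+y≈1)
                                                       (trans (*-comm y x) x*y≈q))))) ⟩
      A * ((x * x) * X) + B * ((y * y) * Y)
        ≈⟨ +-cong (*-congˡ (*-assoc x x X)) (*-congˡ (*-assoc y y Y)) ⟩
      A * (x * (x * X)) + B * (y * (y * Y)) ∎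
      where
      X = pow R x n
      Y = pow R y n

    w*-succ : ∀ t → w* (+ t ℤ.+ + 1) ≈ A * (x * pow R x t) + B * (y * pow R y t)
    w*-succ t = trans (reflexive (≡.cong wPos (ℕ.+-comm t 1))) (wPos-binet (suc t))

    q*w*-pred : ∀ t → q * w* (+ t ℤ.- + 1) ≈ A * (y * pow R x t) + B * (x * pow R y t)
    q*w*-pred zero = begin
      q * ((a - b) * inv q)              ≈⟨ x*[y*x⁻¹]≈y (a - b) q≉0 ⟩
      a - b                              ≈⟨ +-cong a≈[A+B][x+y] (-‿cong (sym Ax+By≈b)) ⟩
      (A + B) * (x + y) - (A * x + B * y)
        ≈⟨ solve 4 (λ A B x y → (A :+ B) :* (x :+ y) :- (A :* x :+ B :* y)
                                := A :* y :+ B :* x)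
                 refl A B x y ⟩
      A * y + B * x                      ≈⟨ +-cong (*-congˡ (*-identityʳ y)) (*-congˡ (*-identityʳ x)) ⟨
      A * (y * 1#) + B * (x * 1#)        ∎
      where
      a≈[A+B][x+y] : a ≈ (A + B) * (x + y)
      a≈[A+B][x+y] = sym (trans (*-cong A+B≈a x+y≈1) (*-identityʳ a))
    q*w*-pred (suc n) = begin
      q * wPos n                             ≈⟨ *-cong (sym x*y≈q) (wPos-binet n) ⟩
      (x * y) * (A * X + B * Y)
        ≈⟨ solve 6 (λ x y A B X Y → (x :* y) :* (A :* X :+ B :* Y)
                                    := A :* (y :* (x :* X)) :+ B :* (x :* (y :* Y)))
                 refl x y A B X Y ⟩
      A * (y * (x * X)) + B * (x * (y * Y))  ∎
      where
      X = pow R x n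
      Y = pow R y n

    w*-shift-difference : ∀ t → w* (+ t ℤ.+ + 1) - q * w* (+ t ℤ.- + 1)
                                  ≈ (x - y) * (A * pow R x t - B * pow R y t)
    w*-shift-difference t = begin
      w* (+ t ℤ.+ + 1) - q * w* (+ t ℤ.- + 1)
        ≈⟨ +-cong (w*-succ t) (-‿cong (q*w*-pred t)) ⟩
      (A * (x * X) + B * (y * Y)) - (A * (y * X) + B * (x * Y))
        ≈⟨ solve 6 (λ x y A B X Y → (A :* (x :* X) :+ B :* (y :* Y)) :- (A :* (y :* X) :+ B :* (x :* Y))
                                    := (x :- y) :* (A :* X :- B :* Y))
                 refl x y A B X Y ⟩
      (x - y) * (A * X - B * Y) ∎
      where
      X = pow R x t
      Y = pow R y t

  module SettingProperties (a b q Δ : Carrier) (q≉0 : ¬ (q ≈ 0#))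
    (disc≉0 : ¬ (1# - fromℕ R 4 * q ≈ 0#)) (Δ²≈disc : Δ * Δ ≈ 1# - fromℕ R 4 * q)
    where
    open Setting R F a b q Δ

    half : Carrier
    half = inv (fromℕ R 2)

    two*half≈1 : fromℕ R 2 * half ≈ 1#
    two*half≈1 = inverseʳ (fromℕ R 2) (charZero 1)

    τ+σ≈1 : τ + σ ≈ 1#
    τ+σ≈1 = begin
      (1# + Δ) * half + (1# - Δ) * half
        ≈⟨ solve 3 (λ o D h → (o :+ D) :* h :+ (o :- D) :* h := (o :+ o) :* h)
                 refl 1# Δ half ⟩
      (1# + 1#) * half ≈⟨ *-congʳ (+-congˡ (+-identityʳ 1#)) ⟨
      fromℕ R 2 * half ≈⟨ two*half≈1 ⟩
      1#               ∎

    τ-σ≈Δ : τ - σ ≈ Δ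
    τ-σ≈Δ = begin
      (1# + Δ) * half - (1# - Δ) * half
        ≈⟨ solve 3 (λ o D h → (o :+ D) :* h :- (o :- D) :* h := D :* (con (+ 2) :* h))
                 refl 1# Δ half ⟩
      Δ * (fromℕ R 2 * half) ≈⟨ *-congˡ two*half≈1 ⟩
      Δ * 1#                 ≈⟨ *-identityʳ Δ ⟩
      Δ                      ∎

    τ*σ≈q : τ * σ ≈ q
    τ*σ≈q = begin
      (1# + Δ) * half * ((1# - Δ) * half)
        ≈⟨ solve 3 (λ o D h → (o :+ D) :* h :* ((o :- D) :* h) := (o :* o :- D :* D) :* h :* h)
                 refl 1# Δ half ⟩
      (1# * 1# - Δ * Δ) * half * half
        ≈⟨ *-congʳ (*-congʳ (+-congʳ (*-identityʳ 1#))) ⟩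
      (1# - Δ * Δ) * half * half
        ≈⟨ *-congʳ (*-congʳ (+-congˡ (-‿cong Δ²≈disc))) ⟩
      (1# - (1# - fromℕ R 4 * q)) * half * half
        ≈⟨ solve 3 (λ o q h → (o :- (o :- con (+ 4) :* q)) :* h :* h
                            := q :* ((con (+ 2) :* h) :* (con (+ 2) :* h)))
                 refl 1# q half ⟩
      q * ((fromℕ R 2 * half) * (fromℕ R 2 * half)) ≈⟨ *-congˡ (*-cong two*half≈1 two*half≈1) ⟩
      q * (1# * 1#)                                 ≈⟨ *-congˡ (*-identityʳ 1#) ⟩
      q * 1#                                        ≈⟨ *-identityʳ q ⟩
      q                                             ∎

    Δ≉0 : ¬ (Δ ≈ 0#)
    Δ≉0 Δ≈0 = disc≉0 (trans (sym Δ²≈disc) (trans (*-congʳ Δ≈0) (zeroˡ Δ)))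

    τ-σ≉0 : ¬ (τ - σ ≈ 0#)
    τ-σ≉0 τ-σ≈0 = Δ≉0 (trans (sym τ-σ≈Δ) τ-σ≈0)

    𝔸+𝔹≈a : 𝔸 + 𝔹 ≈ a
    𝔸+𝔹≈a = begin
      (b - a * σ) * d⁻¹ + (a * τ - b) * d⁻¹
        ≈⟨ solve 5 (λ a b t s e → (b :- a :* s) :* e :+ (a :* t :- b) :* e := (t :- s) :* (a :* e))
                 refl a b τ σ d⁻¹ ⟩
      (τ - σ) * (a * d⁻¹) ≈⟨ x*[y*x⁻¹]≈y a τ-σ≉0 ⟩
      a                   ∎
      where d⁻¹ = inv (τ - σ)

    𝔸τ+𝔹σ≈b : 𝔸 * τ + 𝔹 * σ ≈ b
    𝔸τ+𝔹σ≈b = begin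
      (b - a * σ) * d⁻¹ * τ + (a * τ - b) * d⁻¹ * σ
        ≈⟨ solve 5 (λ a b t s e → (b :- a :* s) :* e :* t :+ (a :* t :- b) :* e :* s := (t :- s) :* (b :* e))
                 refl a b τ σ d⁻¹ ⟩
      (τ - σ) * (b * d⁻¹) ≈⟨ x*[y*x⁻¹]≈y b τ-σ≉0 ⟩
      b                   ∎
      where d⁻¹ = inv (τ - σ)

    open Binet a b q Δ q≉0 τ+σ≈1 τ*σ≈q 𝔸+𝔹≈a 𝔸τ+𝔹σ≈b

    polyEval-binet-sum : ∀ e n → 𝔸 * polyEval e n τ + 𝔹 * polyEval e n σ
                                   ≈ sumR R (λ t → e t * w* (+ t)) n
    polyEval-binet-sum e n = trans (polyEval-linear e n 𝔸 𝔹 τ σ)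
                                   (sumR-cong (λ t → *-congˡ (sym (wPos-binet t))) n)

    polyEval-binet-difference : ∀ e n →
      𝔸 * polyEval e n τ - 𝔹 * polyEval e n σ
        ≈ inv Δ * sumR R (λ t → e t * (w* (+ t ℤ.+ + 1) - q * w* (+ t ℤ.- + 1))) n
    polyEval-binet-difference e n = begin
      D                  ≈⟨ x*[y*x⁻¹]≈y D Δ≉0 ⟨
      Δ * (D * inv Δ)    ≈⟨ solve 3 (λ x y z → x :* (y :* z) := z :* (x :* y)) refl Δ D (inv Δ) ⟩
      inv Δ * (Δ * D)    ≈⟨ *-congˡ Δ*D≈sum ⟩
      inv Δ * sumR R (λ t → e t * (w* (+ t ℤ.+ + 1) - q * w* (+ t ℤ.- + 1))) n ∎
      where
      D = 𝔸 * polyEval e n τ - 𝔹 * polyEval e n σ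
      Pτ = polyEval e n τ
      Pσ = polyEval e n σ
      shift-difference : ∀ t → (Δ * 𝔸) * pow R τ t + (- (Δ * 𝔹)) * pow R σ t
                                 ≈ w* (+ t ℤ.+ + 1) - q * w* (+ t ℤ.- + 1)
      shift-difference t = begin
        (Δ * 𝔸) * X + (- (Δ * 𝔹)) * Y
          ≈⟨ solve 5 (λ D A B X Y → (D :* A) :* X :+ (:- (D :* B)) :* Y := D :* (A :* X :- B :* Y))
                   refl Δ 𝔸 𝔹 X Y ⟩
        Δ * (𝔸 * X - 𝔹 * Y)                       ≈⟨ *-congʳ τ-σ≈Δ ⟨
        (τ - σ) * (𝔸 * X - 𝔹 * Y)                 ≈⟨ w*-shift-difference t ⟨
        w* (+ t ℤ.+ + 1) - q * w* (+ t ℤ.- + 1)  ∎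
        where
        X = pow R τ t
        Y = pow R σ t
      Δ*D≈sum : Δ * D ≈ sumR R (λ t → e t * (w* (+ t ℤ.+ + 1) - q * w* (+ t ℤ.- + 1))) n
      Δ*D≈sum = begin
        Δ * D
          ≈⟨ solve 5 (λ D A B P Q → D :* (A :* P :- B :* Q) := (D :* A) :* P :+ (:- (D :* B)) :* Q)
                   refl Δ 𝔸 𝔹 Pτ Pσ ⟩
        (Δ * 𝔸) * Pτ + (- (Δ * 𝔹)) * Pσ
          ≈⟨ polyEval-linear e n (Δ * 𝔸) (- (Δ * 𝔹)) τ σ ⟩
        sumR R (λ t → e t * ((Δ * 𝔸) * pow R τ t + (- (Δ * 𝔹)) * pow R σ t)) n
          ≈⟨ sumR-cong (λ t → *-congˡ (shift-difference t)) n ⟩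
        sumR R (λ t → e t * (w* (+ t ℤ.+ + 1) - q * w* (+ t ℤ.- + 1))) n ∎

lemma4 : ∀ {c ℓ : Level} (R : CommutativeRing c ℓ) (F : CharZeroField R) →
           let open CommutativeRing R hiding (zero) in
           (a b q Δ : Carrier) →
           ¬ (q ≈ 0#) → ¬ (1# - fromℕ R 4 * q ≈ 0#) → Δ * Δ ≈ 1# - fromℕ R 4 * q →
           let open Setting R F a b q Δ in
           let open CharZeroField F in
           (s : ℕ) →
           (𝔸 * EulerianPoly R s τ + 𝔹 * EulerianPoly R s σ
              ≈ sumR R (λ t → fromℤ R (Eulerian s t) * w* (+ t)) s)
           × (𝔸 * EulerianPoly R s τ - 𝔹 * EulerianPoly R s σ
              ≈ inv Δ * sumR R (λ t → fromℤ R (Eulerian s t)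
                                 * (w* (+ t ℤ.+ + 1) - q * w* (+ t ℤ.- + 1))) s)
lemma4 R F a b q Δ q≉0 disc≉0 Δ²≈disc s =
  polyEval-binet-sum E s , polyEval-binet-difference E s
  where
  open SettingProperties R F a b q Δ q≉0 disc≉0 Δ²≈disc
  E : ℕ → CommutativeRing.Carrier R
  E t = fromℤ R (Eulerian s t)
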